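{- Let $n$ be a positive integer and let $T_n = \{k : 2 \leq k \leq n-1,\ k \equiv n+1 \pmod 2\}$. For every $\pi \in \mathfrak{D}_n$ and every $k \in T_n$, $\mathsf{inv}_D(\mathrm{Sgn\_flip}_k(\pi)) \equiv \mathsf{inv}_D(\pi) \pmod 2$.
   Context: $\mathfrak{B}_n$ is the set of signed permutations of $[n]$, written as words $\pi = \pi_1,\ldots,\pi_n$ with $\pi_i \in \{\pm 1,\ldots,\pm n\}$ and $|\pi_1|,\ldots,|\pi_n|$ a permutation of $[n]$; $\overline{a}$ denotes $-a$. $\mathfrak{D}_n \subseteq \mathfrak{B}_n$ consists of those $\pi$ with an even number of negative entries. $\mathsf{inv}_D(\pi) = |\{1 \le i<j \le n : \pi_i > \pi_j\}| + |\{1 \le i<j \le n : -\pi_i > \pi_j\}|$. For $1 \leq k \leq n$, $\mathrm{Sgn\_flip}_k(\pi) = \pi_1,\ldots,\pi_{k-1},\overline{\pi_k},\ldots,\overline{\pi_n}$. -}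

module Defs where

open import Data.Nat using (ℕ; zero; suc; _+_; _≤_; _<_; _≤ᵇ_)
open import Data.Nat.Properties using ()
open import Data.Integer as ℤ using (ℤ; ∣_∣; -_)
open import Data.Fin using (Fin; toℕ)
open import Data.Fin.Properties using ()
open import Data.List using (List; length; filter; allFin)
open import Data.List.Membership.Propositional using (_∈_)
open import Data.Product using (_×_; _,_; Σ; proj₁; proj₂)
open import Data.Bool using (Bool; true; false; if_then_else_)
open import Relation.Binary.PropositionalEquality using (_≡_)
open import Relation.Nullary.Decidable using (⌊_⌋)
open import Function.Definitions using (Injective)
open import Data.List using (concatMap; map)
open import Data.Nat using () renaming (_<?_ to _<ℕ?_)

-- A word π = π₁ … πₙ over ℤ, position i (0-based Fin n) holds π_{i+1}.
Word : ℕ → Set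
Word n = Fin n → ℤ

IsSignedPerm : (n : ℕ) → Word n → Set
IsSignedPerm n π = ((i : Fin n) → (1 ≤ ∣ π i ∣) × (∣ π i ∣ ≤ n))
                   × Injective _≡_ _≡_ (λ i → ∣ π i ∣)

negCount : (n : ℕ) → Word n → ℕ
negCount n π = length (filter (λ i → π i ℤ.<? ℤ.0ℤ) (allFin n))

data Even : ℕ → Set where
  ev0  : Even 0
  ev+2 : ∀ {m} → Even m → Even (suc (suc m))

InD : (n : ℕ) → Word n → Set
InD n π = IsSignedPerm n π × Even (negCount n π)

pairs : (n : ℕ) → List (Fin n × Fin n)
pairs n = concatMap (λ i → map (λ j → (i , j)) (filter (λ j → toℕ i <ℕ? toℕ j) (allFin n))) (allFin n)

invD : (n : ℕ) → Word n → ℕ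
invD n π = length (filter (λ p → π (proj₂ p) ℤ.<? π (proj₁ p)) (pairs n))
         + length (filter (λ p → π (proj₂ p) ℤ.<? (- π (proj₁ p))) (pairs n))

-- Sgn_flip_k(π) = π₁,…,π_{k-1}, -π_k, …, -π_n  (1-based k; position i is 1-based toℕ i + 1)
sgnFlip : (n : ℕ) → ℕ → Word n → Word n
sgnFlip n k π i = if k ≤ᵇ suc (toℕ i) then - π i else π i

-- For an entry a and a later entry b with ∣a∣ ≠ ∣b∣, an odd number of the comparisons
-- b < a and b < −a hold exactly when ∣b∣ < ∣a∣. Hence inv_D(π) has the parity of the
-- ordinary inversion number of ∣π₁∣ … ∣πₙ∣, which a sign flip does not change.
module Submission where

open import Defs
open import Data.Bool using (true; false; not; _xor_)
open import Data.Bool.Properties using (xor-identityʳ; xor-comm)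
open import Data.Empty using (⊥-elim)
open import Data.Fin using (Fin; toℕ)
open import Data.Integer as ℤ using (+_; -[1+_]; ∣_∣; -_)
open import Data.Integer.Properties using (∣-i∣≡∣i∣)
open import Data.List using (List; []; _∷_; length; filter; map; allFin)
open import Data.List.Membership.Propositional using (_∈_)
open import Data.List.Membership.Propositional.Properties using (∈-concatMap⁻; ∈-map⁻; ∈-filter⁻)
open import Data.List.Properties using (filter-≐)
open import Data.List.Relation.Unary.All as All using (All; []; _∷_)
open import Data.List.Relation.Unary.Any using (satisfied)
open import Data.Nat as ℕ using (ℕ; zero; suc; _+_; _%_; _≤_; _<_)
open import Data.Nat.DivMod using (%-distribˡ-+; [m+n]%n≡m%n)
open import Data.Nat.Properties using (<-cmp; <-irrefl; +-suc; +-comm)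
open import Data.Product using (_×_; _,_; proj₁; proj₂)
open import Function using (_∘_)
open import Function.Definitions using (Injective)
open import Level using (Level)
open import Relation.Binary.Definitions using (tri<; tri≈; tri>)
open import Relation.Binary.PropositionalEquality
open import Relation.Nullary using (does)
open import Relation.Nullary.Decidable using (dec-true; dec-false)
open import Relation.Unary using (Pred; Decidable)

%2-cong-suc : ∀ m n → m % 2 ≡ n % 2 → suc m % 2 ≡ suc n % 2
%2-cong-suc m n m≡n = begin
  (1 + m) % 2         ≡⟨ %-distribˡ-+ 1 m 2 ⟩
  (1 + m % 2) % 2     ≡⟨ cong (λ r → (1 + r) % 2) m≡n ⟩
  (1 + n % 2) % 2     ≡⟨ %-distribˡ-+ 1 n 2 ⟨
  (1 + n) % 2         ∎
  where open ≡-Reasoning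

%2-suc-+-suc : ∀ m n l → (m + n) % 2 ≡ l % 2 → (suc m + suc n) % 2 ≡ l % 2
%2-suc-+-suc m n l m+n≡l = begin
  suc (m + suc n) % 2   ≡⟨ cong (λ k → suc k % 2) (+-suc m n) ⟩
  (2 + (m + n)) % 2     ≡⟨ cong (_% 2) (+-comm 2 (m + n)) ⟩
  ((m + n) + 2) % 2     ≡⟨ [m+n]%n≡m%n (m + n) 2 ⟩
  (m + n) % 2           ≡⟨ m+n≡l ⟩
  l % 2                 ∎
  where open ≡-Reasoning

%2-+-suc : ∀ m n l → (m + n) % 2 ≡ l % 2 → (m + suc n) % 2 ≡ suc l % 2
%2-+-suc m n l m+n≡l = trans (cong (_% 2) (+-suc m n)) (%2-cong-suc (m + n) l m+n≡l)

module _ {a : Level} {A : Set a} where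

  count : ∀ {ℓ} {X : Pred A ℓ} → Decidable X → List A → ℕ
  count X? xs = length (filter X? xs)

  count-xor : ∀ {p q r} {P : Pred A p} {Q : Pred A q} {R : Pred A r}
    (P? : Decidable P) (Q? : Decidable Q) (R? : Decidable R) (xs : List A) →
    All (λ x → does (P? x) xor does (Q? x) ≡ does (R? x)) xs →
    (count P? xs + count Q? xs) % 2 ≡ count R? xs % 2
  count-xor P? Q? R? [] [] = refl
  count-xor P? Q? R? (x ∷ xs) (e ∷ es)
    with does (P? x) | does (Q? x) | does (R? x) | count-xor P? Q? R? xs es
  ... | true  | true  | false | ih = %2-suc-+-suc (count P? xs) (count Q? xs) (count R? xs) ih
  ... | true  | false | true  | ih = %2-cong-suc (count P? xs + count Q? xs) (count R? xs) ih
  ... | false | true  | true  | ih = %2-+-suc (count P? xs) (count Q? xs) (count R? xs) ih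
  ... | false | false | false | ih = ih
  count-xor P? Q? R? (_ ∷ _) (() ∷ _) | true  | true  | true  | _
  count-xor P? Q? R? (_ ∷ _) (() ∷ _) | true  | false | false | _
  count-xor P? Q? R? (_ ∷ _) (() ∷ _) | false | true  | false | _
  count-xor P? Q? R? (_ ∷ _) (() ∷ _) | false | false | true  | _

<?-flip : ∀ {x y} → x ≢ y → does (x ℕ.<? y) ≡ not (does (y ℕ.<? x))
<?-flip {x} {y} x≢y with <-cmp x y
... | tri< x<y _ y≮x rewrite dec-true (x ℕ.<? y) x<y | dec-false (y ℕ.<? x) y≮x = refl
... | tri≈ _ x≡y _ = ⊥-elim (x≢y x≡y)
... | tri> x≮y _ y<x rewrite dec-false (x ℕ.<? y) x≮y | dec-true (y ℕ.<? x) y<x = refl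

<?-xor-<?-neg : ∀ a b → ∣ a ∣ ≢ ∣ b ∣ → does (b ℤ.<? a) xor does (b ℤ.<? - a) ≡ does (∣ b ∣ ℕ.<? ∣ a ∣)
<?-xor-<?-neg (+ zero)   (+ y)      _   = refl
<?-xor-<?-neg (+ zero)   -[1+ y ]   _   = refl
<?-xor-<?-neg (+ suc x)  (+ y)      _   = xor-identityʳ (does (y ℕ.<? suc x))
<?-xor-<?-neg (+ suc x)  -[1+ y ]   a≢b = sym (<?-flip (a≢b ∘ cong suc ∘ sym))
<?-xor-<?-neg -[1+ x ]   (+ y)      _   = refl
<?-xor-<?-neg -[1+ x ]   -[1+ y ]   a≢b =
  trans (xor-comm (does (x ℕ.<? y)) true) (sym (<?-flip (a≢b ∘ cong suc ∘ sym)))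

pairs-< : ∀ {n} {p : Fin n × Fin n} → p ∈ pairs n → toℕ (proj₁ p) < toℕ (proj₂ p)
pairs-< {n} p∈pairs
  with satisfied (∈-concatMap⁻ (λ i → map (i ,_) (filter (λ j → toℕ i ℕ.<? toℕ j) (allFin n)))
                               {xs = allFin n} p∈pairs)
... | i , p∈row with ∈-map⁻ (i ,_) p∈row
...   | j , j∈ , refl = proj₂ (∈-filter⁻ (λ j → toℕ i ℕ.<? toℕ j) {xs = allFin n} j∈)

inversions : (n : ℕ) → (Fin n → ℕ) → ℕ
inversions n g = count (λ p → g (proj₂ p) ℕ.<? g (proj₁ p)) (pairs n)

inversions-cong : ∀ n {f g : Fin n → ℕ} → (∀ i → f i ≡ g i) → inversions n f ≡ inversions n g
inversions-cong n f≗g = cong length (filter-≐ _ _ (transport f≗g , transport (sym ∘ f≗g)) (pairs n))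
  where
    transport : ∀ {f g : Fin n → ℕ} → (∀ i → f i ≡ g i) → ∀ {p : Fin n × Fin n} →
      f (proj₂ p) < f (proj₁ p) → g (proj₂ p) < g (proj₁ p)
    transport f≗g {i , j} = subst₂ _<_ (f≗g j) (f≗g i)

invD≡inversions-∣∣-mod-2 : ∀ n (π : Word n) → Injective _≡_ _≡_ (∣_∣ ∘ π) →
  invD n π % 2 ≡ inversions n (∣_∣ ∘ π) % 2
invD≡inversions-∣∣-mod-2 n π inj = count-xor _ _ _ (pairs n) (All.tabulate pair-parity)
  where
    pair-parity : ∀ {p} → p ∈ pairs n →
      does (π (proj₂ p) ℤ.<? π (proj₁ p)) xor does (π (proj₂ p) ℤ.<? - π (proj₁ p))
        ≡ does (∣ π (proj₂ p) ∣ ℕ.<? ∣ π (proj₁ p) ∣)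
    pair-parity {i , j} p∈pairs =
      <?-xor-<?-neg (π i) (π j) (λ ∣πi∣≡∣πj∣ → <-irrefl (cong toℕ (inj ∣πi∣≡∣πj∣)) (pairs-< p∈pairs))

∣sgnFlip∣ : ∀ n k (π : Word n) i → ∣ sgnFlip n k π i ∣ ≡ ∣ π i ∣
∣sgnFlip∣ n k π i with k ℕ.≤ᵇ suc (toℕ i)
... | true  = ∣-i∣≡∣i∣ (π i)
... | false = refl

lemma14 : (n : ℕ) → 1 ≤ n → (π : Word n) → InD n π →
          (k : ℕ) → 2 ≤ k → suc k ≤ n → k % 2 ≡ (n + 1) % 2 →
          invD n (sgnFlip n k π) % 2 ≡ invD n π % 2
lemma14 n _ π ((_ , inj) , _) k _ _ _ = begin
  invD n π′ % 2                 ≡⟨ invD≡inversions-∣∣-mod-2 n π′ inj′ ⟩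
  inversions n (∣_∣ ∘ π′) % 2   ≡⟨ cong (_% 2) (inversions-cong n (∣sgnFlip∣ n k π)) ⟩
  inversions n (∣_∣ ∘ π) % 2    ≡⟨ invD≡inversions-∣∣-mod-2 n π inj ⟨
  invD n π % 2                  ∎
  where
    open ≡-Reasoning
    π′ = sgnFlip n k π
    inj′ : Injective _≡_ _≡_ (∣_∣ ∘ π′)
    inj′ {i} {j} ∣π′i∣≡∣π′j∣ = inj (trans (sym (∣sgnFlip∣ n k π i)) (trans ∣π′i∣≡∣π′j∣ (∣sgnFlip∣ n k π j)))
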